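{- For all integers $n\geq 0$ and $k\in\mathbb{Z}$, \[ E_{n}^{(k)}(x)=\sum_{l=0}^{n}\sum_{m=0}^{l}\sum_{j=1}^{m+1}\binom{n}{l}\binom{l}{m}\frac{2^{m+n-l}(-1)^{m+1+j}\,j!}{(l-m+1)\,j^{k}\,(m+1)}\,S_{2}(m+1,j)\,B_{n-l}\!\left(\tfrac{x}{2}\right). \]
   Context: For $k\in\mathbb{Z}$, $\mathrm{Li}_k(z)=\sum_{n=1}^{\infty}\frac{z^n}{n^k}$. The poly-Euler polynomials $E_n^{(k)}(x)$ are defined by the generating function (formal power series in $t$) \[ \frac{\mathrm{Li}_{k}(1-e^{ -2t})}{t(e^{t}+1)}e^{xt}=\sum_{n=0}^{\infty}E_{n}^{(k)}(x)\frac{t^{n}}{n!}. \] The Bernoulli polynomials are defined by $\frac{t}{e^t-1}e^{xt}=\sum_{n\ge0}B_n(x)\frac{t^n}{n!}$. The Stirling numbers of the second kind are defined by $\frac{1}{m!}(e^t-1)^m=\sum_{n=m}^{\infty}S_2(n,m)\frac{t^n}{n!}$. -}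

module Defs where

open import Data.Nat as ℕ using (ℕ; zero; suc; _∸_; _!; _≤ᵇ_)
open import Data.Nat.Properties using (_!≢0)
open import Data.Bool using (if_then_else_)
open import Data.Integer as ℤ using (ℤ; +_; -[1+_])
open import Data.Rational using (ℚ; _+_; _*_; -_; _-_; _/_; 0ℚ; 1ℚ; ½)

ℕ→ℚ : ℕ → ℚ
ℕ→ℚ n = + n / 1

ℤ→ℚ : ℤ → ℚ
ℤ→ℚ z = z / 1

inv! : ℕ → ℚ
inv! n = _/_ (+ 1) (n !) {{n !≢0}}

infixr 8 _^ℚ_
_^ℚ_ : ℚ → ℕ → ℚ
q ^ℚ zero  = 1ℚ
q ^ℚ suc m = q * q ^ℚ m

sgn : ℕ → ℚ
sgn m = (- 1ℚ) ^ℚ m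

sum< : ℕ → (ℕ → ℚ) → ℚ
sum< zero    f = 0ℚ
sum< (suc n) f = sum< n f + f n

-- Σ_{i=a}^{b} f i   (empty if b < a)
Σ[_⋯_] : ℕ → ℕ → (ℕ → ℚ) → ℚ
Σ[ a ⋯ b ] f = sum< (suc b ∸ a) (λ i → f (a ℕ.+ i))

-- 1 / j^k for a positive integer j = suc j' and k ∈ ℤ
-- (for k = -(b+1) this is j^(b+1))
inv-pow : ℕ → ℤ → ℚ
inv-pow j' (+ a)      = (+ 1 / suc j') ^ℚ a
inv-pow j' -[1+ b ]   = ℕ→ℚ (suc j') ^ℚ suc b

-- Formal power series in t with rational coefficients (ordinary
-- coefficients: f n is the coefficient of t^n).

FPS : Set
FPS = ℕ → ℚ

_⊛_ : FPS → FPS → FPS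
(f ⊛ g) n = Σ[ 0 ⋯ n ] (λ i → f i * g (n ∸ i))

_⊕_ : FPS → FPS → FPS
(f ⊕ g) n = f n + g n

powS : FPS → ℕ → FPS
powS f zero    zero    = 1ℚ
powS f zero    (suc n) = 0ℚ
powS f (suc m)         = f ⊛ powS f m

const : ℚ → FPS
const c zero    = c
const c (suc n) = 0ℚ

expS : ℚ → FPS
expS a n = a ^ℚ n * inv! n

-- multiplicative inverse of a series f whose constant term f 0 has
-- reciprocal c (i.e. c * f 0 = 1):  g 0 = c,
-- g n = - c * Σ_{i=1}^{n} f i * g (n - i).
-- invApprox f c N i is correct for i ≤ N.
invApprox : FPS → ℚ → ℕ → FPS
invApprox f c zero    i = c
invApprox f c (suc N) i =
  if i ≤ᵇ N then invApprox f c N i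
  else - (c * Σ[ 1 ⋯ suc N ] (λ j → f j * invApprox f c N (suc N ∸ j)))

invS : FPS → ℚ → FPS
invS f c n = invApprox f c n n

divT : FPS → FPS
divT f n = f (suc n)

-- Li_k(g(t)) for a series g with zero constant term:
-- Σ_{m ≥ 1} g^m / m^k ; the coefficient of t^n only involves m ≤ n.
LiS : ℤ → FPS → FPS
LiS k g n = Σ[ 1 ⋯ n ] (λ m → inv-pow (m ∸ 1) k * powS g m n)

oneMinusExpNeg2 : FPS
oneMinusExpNeg2 = const 1ℚ ⊕ (λ n → - expS (ℤ→ℚ (ℤ.- + 2)) n)

-- e^t + 1  (constant term 2, reciprocal ½)
expPlusOne : FPS
expPlusOne = expS 1ℚ ⊕ const 1ℚ

expMinusOne : FPS
expMinusOne = expS 1ℚ ⊕ const (- 1ℚ)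

-- poly-Euler polynomial E_n^{(k)}(x):
-- Li_k(1-e^{-2t}) / (t (e^t+1)) * e^{xt} = Σ E_n^{(k)}(x) t^n / n!
polyEuler : ℕ → ℤ → ℚ → ℚ
polyEuler n k x =
  ℕ→ℚ (n !) * ((divT (LiS k oneMinusExpNeg2) ⊛ invS expPlusOne ½) ⊛ expS x) n

-- Bernoulli polynomial B_n(x):  t/(e^t-1) e^{xt} = Σ B_n(x) t^n/n!
-- (t/(e^t-1) is the inverse of (e^t-1)/t, whose constant term is 1)
bernoulliPoly : ℕ → ℚ → ℚ
bernoulliPoly n x = ℕ→ℚ (n !) * (invS (divT expMinusOne) 1ℚ ⊛ expS x) n

-- Stirling numbers of the second kind:
-- (e^t-1)^m / m! = Σ_{n ≥ m} S2(n,m) t^n/n!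
stirling2 : ℕ → ℕ → ℚ
stirling2 n m = ℕ→ℚ (n !) * inv! m * powS expMinusOne m n

{-# OPTIONS --safe #-}
module Submission where

-- Since 1/(e^t+1) = (e^t-1)/(e^{2t}-1) = ½ · ((e^t-1)/t) · (2t/(e^{2t}-1)), the generating
-- function of E_n^{(k)}(x) is ½ times the product of Li_k(1-e^{-2t})/t, of (e^t-1)/t = Σ t^i/(i+1)!
-- and of (2t/(e^{2t}-1)) e^{xt}, which generates 2^n B_n(x/2)/n!.  As 1-e^{-2t} is -(e^s-1) at
-- s = -2t, the coefficient of t^{m+1} in (1-e^{-2t})^j is (-2)^{m+1} (-1)^j j! S_2(m+1,j)/(m+1)!.
-- Multiplying the three series out and collecting the factorials into binomial coefficients
-- gives the triple sum.

open import Defs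
open import Data.Bool using (T; true; false)
open import Data.Nat as ℕ using (ℕ; zero; suc; _∸_; _!; _≤ᵇ_) renaming (_+_ to _+ℕ_)
import Data.Nat.Properties as ℕₚ
open import Data.Nat.Combinatorics using (_C_; nCk≡n!/k![n-k]!; k![n∸k]!∣n!)
open import Data.Nat.DivMod using (m/n*n≡m)
open import Data.Integer as ℤ using (ℤ; +_)
import Data.Integer.Properties as ℤₚ
open import Data.Rational using (ℚ; _*_; _/_; ½; _+_; -_; 0ℚ; 1ℚ; fromℚᵘ)
open import Data.Rational.Properties
import Data.Rational.Unnormalised as ℚᵘ
import Data.Rational.Unnormalised.Properties as ℚᵘₚ
open import Data.Rational.Solver using (module +-*-Solver)
open +-*-Solver using (solve; _:=_; _:+_; _:*_; :-_; con)
open import Data.Empty using (⊥-elim)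
open import Data.Sum using (inj₁; inj₂)
open import Relation.Binary.Bundles using (Setoid)
open import Relation.Binary.PropositionalEquality hiding (J)
import Relation.Binary.Reasoning.Setoid as SetoidReasoning

fromℚᵘ-homo-+ : ∀ p q → fromℚᵘ (p ℚᵘ.+ q) ≡ fromℚᵘ p + fromℚᵘ q
fromℚᵘ-homo-+ p q = toℚᵘ-injective (ℚᵘₚ.≃-trans (toℚᵘ-fromℚᵘ (p ℚᵘ.+ q)) (ℚᵘₚ.≃-trans
  (ℚᵘₚ.+-cong (ℚᵘₚ.≃-sym (toℚᵘ-fromℚᵘ p)) (ℚᵘₚ.≃-sym (toℚᵘ-fromℚᵘ q)))
  (ℚᵘₚ.≃-sym (toℚᵘ-homo-+ (fromℚᵘ p) (fromℚᵘ q)))))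

fromℚᵘ-homo-* : ∀ p q → fromℚᵘ (p ℚᵘ.* q) ≡ fromℚᵘ p * fromℚᵘ q
fromℚᵘ-homo-* p q = toℚᵘ-injective (ℚᵘₚ.≃-trans (toℚᵘ-fromℚᵘ (p ℚᵘ.* q)) (ℚᵘₚ.≃-trans
  (ℚᵘₚ.*-cong (ℚᵘₚ.≃-sym (toℚᵘ-fromℚᵘ p)) (ℚᵘₚ.≃-sym (toℚᵘ-fromℚᵘ q)))
  (ℚᵘₚ.≃-sym (toℚᵘ-homo-* (fromℚᵘ p) (fromℚᵘ q)))))

ℕ→ℚ-homo-+ : ∀ a b → ℕ→ℚ (a +ℕ b) ≡ ℕ→ℚ a + ℕ→ℚ b
ℕ→ℚ-homo-+ a b = trans (fromℚᵘ-cong {ℚᵘ.mkℚᵘ (+ (a +ℕ b)) 0} {a′ ℚᵘ.+ b′} (ℚᵘ.*≡* eq)) (fromℚᵘ-homo-+ a′ b′)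
  where
  a′ b′ : ℚᵘ.ℚᵘ
  a′ = ℚᵘ.mkℚᵘ (+ a) 0
  b′ = ℚᵘ.mkℚᵘ (+ b) 0
  eq : + (a +ℕ b) ℤ.* + 1 ≡ (+ a ℤ.* + 1 ℤ.+ + b ℤ.* + 1) ℤ.* + 1
  eq = cong (ℤ._* + 1) (sym (cong₂ ℤ._+_ (ℤₚ.*-identityʳ (+ a)) (ℤₚ.*-identityʳ (+ b))))

ℕ→ℚ-homo-* : ∀ a b → ℕ→ℚ (a ℕ.* b) ≡ ℕ→ℚ a * ℕ→ℚ b
ℕ→ℚ-homo-* a b = trans (fromℚᵘ-cong {ℚᵘ.mkℚᵘ (+ (a ℕ.* b)) 0} {a′ ℚᵘ.* b′} (ℚᵘ.*≡* eq)) (fromℚᵘ-homo-* a′ b′)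
  where
  a′ b′ : ℚᵘ.ℚᵘ
  a′ = ℚᵘ.mkℚᵘ (+ a) 0
  b′ = ℚᵘ.mkℚᵘ (+ b) 0
  eq : + (a ℕ.* b) ℤ.* + 1 ≡ (+ a ℤ.* + b) ℤ.* + 1
  eq = cong (ℤ._* + 1) (ℤₚ.pos-* a b)

1/n*n≡1 : ∀ n .{{_ : ℕ.NonZero n}} → (+ 1 / n) * ℕ→ℚ n ≡ 1ℚ
1/n*n≡1 (suc n) = trans (sym (fromℚᵘ-homo-* r n′)) (fromℚᵘ-cong {r ℚᵘ.* n′} {ℚᵘ.mkℚᵘ (+ 1) 0} (ℚᵘ.*≡* eq))
  where
  r n′ : ℚᵘ.ℚᵘ
  r  = ℚᵘ.mkℚᵘ (+ 1) n
  n′ = ℚᵘ.mkℚᵘ (+ suc n) 0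
  eq : (+ 1 ℤ.* + suc n) ℤ.* + 1 ≡ + 1 ℤ.* + (suc n ℕ.* 1)
  eq = trans (ℤₚ.*-identityʳ _) (cong (λ d → + 1 ℤ.* + d) (sym (ℕₚ.*-identityʳ (suc n))))

inverse-unique : ∀ x y d → x * d ≡ 1ℚ → y * d ≡ 1ℚ → x ≡ y
inverse-unique x y d x*d≡1 y*d≡1 = begin
    x            ≡⟨ sym (*-identityʳ x) ⟩
    x * 1ℚ       ≡⟨ cong (x *_) (sym y*d≡1) ⟩
    x * (y * d)  ≡⟨ solve 3 (λ x y d → x :* (y :* d) := (x :* d) :* y) refl x y d ⟩
    (x * d) * y  ≡⟨ cong (_* y) x*d≡1 ⟩
    1ℚ * y       ≡⟨ *-identityˡ y ⟩
    y            ∎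
  where open ≡-Reasoning

suc-*-cancelˡ : ∀ n {x y} → ℕ→ℚ (suc n) * x ≡ ℕ→ℚ (suc n) * y → x ≡ y
suc-*-cancelˡ n {x} {y} eq = begin
    x                                  ≡⟨ sym (cancel x) ⟩
    (+ 1 / suc n) * (ℕ→ℚ (suc n) * x)  ≡⟨ cong ((+ 1 / suc n) *_) eq ⟩
    (+ 1 / suc n) * (ℕ→ℚ (suc n) * y)  ≡⟨ cancel y ⟩
    y                                  ∎
  where
  open ≡-Reasoning
  cancel : ∀ z → (+ 1 / suc n) * (ℕ→ℚ (suc n) * z) ≡ z
  cancel z = trans (sym (*-assoc (+ 1 / suc n) (ℕ→ℚ (suc n)) z)) (trans (cong (_* z) (1/n*n≡1 (suc n))) (*-identityˡ z))

^ℚ-+ : ∀ c a b → c ^ℚ (a +ℕ b) ≡ c ^ℚ a * c ^ℚ b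
^ℚ-+ c zero    b = sym (*-identityˡ _)
^ℚ-+ c (suc a) b = trans (cong (c *_) (^ℚ-+ c a b)) (sym (*-assoc c _ _))

*-^ℚ : ∀ c d a → (c * d) ^ℚ a ≡ c ^ℚ a * d ^ℚ a
*-^ℚ c d zero    = refl
*-^ℚ c d (suc a) = trans (cong ((c * d) *_) (*-^ℚ c d a))
  (solve 4 (λ c d x y → (c :* d) :* (x :* y) := (c :* x) :* (d :* y)) refl c d (c ^ℚ a) (d ^ℚ a))

1^ℚ : ∀ a → 1ℚ ^ℚ a ≡ 1ℚ
1^ℚ zero    = refl
1^ℚ (suc a) = trans (*-identityˡ _) (1^ℚ a)

inv!-inverseˡ : ∀ n → inv! n * ℕ→ℚ (n !) ≡ 1ℚ
inv!-inverseˡ n = 1/n*n≡1 (n !) {{n ℕₚ.!≢0}}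

inv!-inverseʳ : ∀ n → ℕ→ℚ (n !) * inv! n ≡ 1ℚ
inv!-inverseʳ n = trans (*-comm _ (inv! n)) (inv!-inverseˡ n)

inv!-suc : ∀ n → inv! (suc n) ≡ inv! n * (+ 1 / suc n)
inv!-suc n = inverse-unique _ _ (ℕ→ℚ (suc n !)) (inv!-inverseˡ (suc n)) (begin
    inv! n * (+ 1 / suc n) * ℕ→ℚ (suc n !)
  ≡⟨ cong (inv! n * (+ 1 / suc n) *_) (ℕ→ℚ-homo-* (suc n) (n !)) ⟩
    inv! n * (+ 1 / suc n) * (ℕ→ℚ (suc n) * ℕ→ℚ (n !))
  ≡⟨ solve 4 (λ a b c d → a :* b :* (c :* d) := (a :* d) :* (b :* c)) refl
       (inv! n) (+ 1 / suc n) (ℕ→ℚ (suc n)) (ℕ→ℚ (n !)) ⟩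
    (inv! n * ℕ→ℚ (n !)) * ((+ 1 / suc n) * ℕ→ℚ (suc n))
  ≡⟨ cong₂ _*_ (inv!-inverseˡ n) (1/n*n≡1 (suc n)) ⟩
    1ℚ ∎)
  where open ≡-Reasoning

suc*inv!-suc : ∀ n → ℕ→ℚ (suc n) * inv! (suc n) ≡ inv! n
suc*inv!-suc n = begin
    ℕ→ℚ (suc n) * inv! (suc n)               ≡⟨ cong (ℕ→ℚ (suc n) *_) (inv!-suc n) ⟩
    ℕ→ℚ (suc n) * (inv! n * (+ 1 / suc n))   ≡⟨ solve 3 (λ s a r → s :* (a :* r) := a :* (r :* s)) refl
                                                   (ℕ→ℚ (suc n)) (inv! n) (+ 1 / suc n) ⟩
    inv! n * ((+ 1 / suc n) * ℕ→ℚ (suc n))   ≡⟨ cong (inv! n *_) (1/n*n≡1 (suc n)) ⟩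
    inv! n * 1ℚ                              ≡⟨ *-identityʳ (inv! n) ⟩
    inv! n                                   ∎
  where open ≡-Reasoning

nCk*k!*[n∸k]!≡n! : ∀ n k → k ℕ.≤ n → (n C k) ℕ.* (k ! ℕ.* (n ∸ k) !) ≡ n !
nCk*k!*[n∸k]!≡n! n k k≤n = trans (cong (ℕ._* (k ! ℕ.* (n ∸ k) !)) (nCk≡n!/k![n-k]! k≤n))
  (m/n*n≡m {{ℕₚ.m*n≢0 (k !) ((n ∸ k) !) {{k ℕₚ.!≢0}} {{(n ∸ k) ℕₚ.!≢0}}}} (k![n∸k]!∣n! k≤n))

nCk≡n!*inv!k*inv![n∸k] : ∀ n k → k ℕ.≤ n → ℕ→ℚ (n C k) ≡ ℕ→ℚ (n !) * (inv! k * inv! (n ∸ k))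
nCk≡n!*inv!k*inv![n∸k] n k k≤n = sym (begin
    ℕ→ℚ (n !) * (inv! k * inv! (n ∸ k))
  ≡⟨ cong (λ z → ℕ→ℚ z * (inv! k * inv! (n ∸ k))) (sym (nCk*k!*[n∸k]!≡n! n k k≤n)) ⟩
    ℕ→ℚ ((n C k) ℕ.* (k ! ℕ.* (n ∸ k) !)) * (inv! k * inv! (n ∸ k))
  ≡⟨ cong (_* (inv! k * inv! (n ∸ k)))
       (trans (ℕ→ℚ-homo-* (n C k) _) (cong (ℕ→ℚ (n C k) *_) (ℕ→ℚ-homo-* (k !) ((n ∸ k) !)))) ⟩
    ℕ→ℚ (n C k) * (ℕ→ℚ (k !) * ℕ→ℚ ((n ∸ k) !)) * (inv! k * inv! (n ∸ k))
  ≡⟨ solve 5 (λ c a b a' b' → c :* (a :* b) :* (a' :* b') := c :* (a :* a') :* (b :* b')) refl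
       (ℕ→ℚ (n C k)) (ℕ→ℚ (k !)) (ℕ→ℚ ((n ∸ k) !)) (inv! k) (inv! (n ∸ k)) ⟩
    ℕ→ℚ (n C k) * (ℕ→ℚ (k !) * inv! k) * (ℕ→ℚ ((n ∸ k) !) * inv! (n ∸ k))
  ≡⟨ cong₂ (λ u v → ℕ→ℚ (n C k) * u * v) (inv!-inverseʳ k) (inv!-inverseʳ (n ∸ k)) ⟩
    ℕ→ℚ (n C k) * 1ℚ * 1ℚ
  ≡⟨ trans (*-identityʳ _) (*-identityʳ _) ⟩
    ℕ→ℚ (n C k) ∎)
  where open ≡-Reasoning

multinomial : ∀ n l m → l ℕ.≤ n → m ℕ.≤ l →
  ℕ→ℚ (n !) * (inv! m * inv! (l ∸ m) * inv! (n ∸ l)) ≡ ℕ→ℚ (n C l) * ℕ→ℚ (l C m)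
multinomial n l m l≤n m≤l = begin
    ℕ→ℚ (n !) * (inv! m * inv! (l ∸ m) * inv! (n ∸ l))
  ≡⟨ sym (trans (cong (lhs *_) (inv!-inverseʳ l)) (*-identityʳ lhs)) ⟩
    ℕ→ℚ (n !) * (inv! m * inv! (l ∸ m) * inv! (n ∸ l)) * (ℕ→ℚ (l !) * inv! l)
  ≡⟨ solve 6 (λ N a b c L i → N :* (a :* b :* c) :* (L :* i) := N :* (i :* c) :* (L :* (a :* b))) refl
       (ℕ→ℚ (n !)) (inv! m) (inv! (l ∸ m)) (inv! (n ∸ l)) (ℕ→ℚ (l !)) (inv! l) ⟩
    ℕ→ℚ (n !) * (inv! l * inv! (n ∸ l)) * (ℕ→ℚ (l !) * (inv! m * inv! (l ∸ m)))
  ≡⟨ sym (cong₂ _*_ (nCk≡n!*inv!k*inv![n∸k] n l l≤n) (nCk≡n!*inv!k*inv![n∸k] l m m≤l)) ⟩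
    ℕ→ℚ (n C l) * ℕ→ℚ (l C m) ∎
  where
  open ≡-Reasoning
  lhs : ℚ
  lhs = ℕ→ℚ (n !) * (inv! m * inv! (l ∸ m) * inv! (n ∸ l))

sum<-cong : ∀ n {f g : ℕ → ℚ} → f ≗ g → sum< n f ≡ sum< n g
sum<-cong zero    f≗g = refl
sum<-cong (suc n) f≗g = cong₂ _+_ (sum<-cong n f≗g) (f≗g n)

sum<-cong< : ∀ n {f g : ℕ → ℚ} → (∀ i → i ℕ.< n → f i ≡ g i) → sum< n f ≡ sum< n g
sum<-cong< zero    eq = refl
sum<-cong< (suc n) eq =
  cong₂ _+_ (sum<-cong< n (λ i i<n → eq i (ℕₚ.m<n⇒m<1+n i<n))) (eq n (ℕₚ.n<1+n n))

sum<-zero : ∀ n → sum< n (λ _ → 0ℚ) ≡ 0ℚ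
sum<-zero zero    = refl
sum<-zero (suc n) = cong (_+ 0ℚ) (sum<-zero n)

sum<-+ : ∀ n (f g : ℕ → ℚ) → sum< n (λ i → f i + g i) ≡ sum< n f + sum< n g
sum<-+ zero    f g = refl
sum<-+ (suc n) f g = trans (cong (_+ (f n + g n)) (sum<-+ n f g))
  (solve 4 (λ a b c d → (a :+ b) :+ (c :+ d) := (a :+ c) :+ (b :+ d)) refl (sum< n f) (sum< n g) (f n) (g n))

sum<-*ˡ : ∀ n c (f : ℕ → ℚ) → sum< n (λ i → c * f i) ≡ c * sum< n f
sum<-*ˡ zero    c f = sym (*-zeroʳ c)
sum<-*ˡ (suc n) c f = trans (cong (_+ (c * f n)) (sum<-*ˡ n c f)) (sym (*-distribˡ-+ c (sum< n f) (f n)))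

sum<-*ʳ : ∀ n c (f : ℕ → ℚ) → sum< n (λ i → f i * c) ≡ sum< n f * c
sum<-*ʳ n c f = trans (sum<-cong n (λ i → *-comm (f i) c)) (trans (sum<-*ˡ n c f) (*-comm c _))

sum<-distrib : ∀ n a b (f : ℕ → ℚ) → a * (sum< n f * b) ≡ sum< n (λ i → a * (f i * b))
sum<-distrib n a b f = trans (cong (a *_) (sym (sum<-*ʳ n b f))) (sym (sum<-*ˡ n a (λ i → f i * b)))

sum<-unconsˡ : ∀ n (f : ℕ → ℚ) → sum< (suc n) f ≡ f 0 + sum< n (λ i → f (suc i))
sum<-unconsˡ zero    f = trans (+-identityˡ (f 0)) (sym (+-identityʳ (f 0)))
sum<-unconsˡ (suc n) f = trans (cong (_+ f (suc n)) (sum<-unconsˡ n f)) (+-assoc (f 0) _ _)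

sum<-reverse : ∀ n (f : ℕ → ℚ) → sum< n f ≡ sum< n (λ i → f (n ∸ suc i))
sum<-reverse zero    f = refl
sum<-reverse (suc n) f = trans (cong (_+ f n) (sum<-reverse n f))
  (trans (+-comm _ (f n)) (sym (sum<-unconsˡ n (λ i → f (n ∸ i)))))

sum<-triangle : ∀ n (F : ℕ → ℕ → ℚ) →
  sum< (suc n) (λ l → sum< (suc l) (λ m → F m l)) ≡
  sum< (suc n) (λ m → sum< (suc n ∸ m) (λ i → F m (m +ℕ i)))
sum<-triangle zero    F = refl
sum<-triangle (suc n) F = begin
    sum< (suc n) (λ l → sum< (suc l) (λ m → F m l)) + sum< (suc (suc n)) (λ m → F m (suc n))
  ≡⟨ cong (_+ sum< (suc (suc n)) (λ m → F m (suc n))) (sum<-triangle n F) ⟩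
    sum< (suc n) rows + sum< (suc (suc n)) (λ m → F m (suc n))
  ≡⟨ cong (_+ sum< (suc (suc n)) (λ m → F m (suc n))) (sym append-empty-row) ⟩
    sum< (suc (suc n)) rows + sum< (suc (suc n)) (λ m → F m (suc n))
  ≡⟨ sym (sum<-+ (suc (suc n)) rows (λ m → F m (suc n))) ⟩
    sum< (suc (suc n)) (λ m → rows m + F m (suc n))
  ≡⟨ sum<-cong< (suc (suc n)) (λ m m<2+n → sym (extend m (ℕₚ.≤-pred m<2+n))) ⟩
    sum< (suc (suc n)) (λ m → sum< (suc (suc n) ∸ m) (λ i → F m (m +ℕ i)))
  ∎
  where
  open ≡-Reasoning
  rows : ℕ → ℚ
  rows m = sum< (suc n ∸ m) (λ i → F m (m +ℕ i))
  append-empty-row : sum< (suc (suc n)) rows ≡ sum< (suc n) rows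
  append-empty-row = trans (cong (_+_ (sum< (suc n) rows)) (cong (λ len → sum< len (λ i → F (suc n) (suc n +ℕ i))) (ℕₚ.n∸n≡0 n)))
    (+-identityʳ (sum< (suc n) rows))
  extend : ∀ m → m ℕ.≤ suc n → sum< (suc (suc n) ∸ m) (λ i → F m (m +ℕ i)) ≡ rows m + F m (suc n)
  extend m m≤1+n rewrite ℕₚ.+-∸-assoc 1 m≤1+n =
    cong (λ z → rows m + z) (cong (F m) (ℕₚ.m+[n∸m]≡n m≤1+n))

module ≗-Reasoning = SetoidReasoning (ℕ →-setoid ℚ)
open Setoid (ℕ →-setoid ℚ) using () renaming (sym to ≗-sym; trans to ≗-trans)

infixr 7 _·_
_·_ : ℚ → FPS → FPS
(c · f) n = c * f n

scale : ℚ → FPS → FPS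
scale c f n = c ^ℚ n * f n

·-cong : ∀ c {f g} → f ≗ g → c · f ≗ c · g
·-cong c f≗g n = cong (c *_) (f≗g n)

scale-cong : ∀ c {f g} → f ≗ g → scale c f ≗ scale c g
scale-cong c f≗g n = cong (c ^ℚ n *_) (f≗g n)

⊛-cong : ∀ {f f′ g g′} → f ≗ f′ → g ≗ g′ → f ⊛ g ≗ f′ ⊛ g′
⊛-cong f≗f′ g≗g′ n = sum<-cong (suc n) (λ i → cong₂ _*_ (f≗f′ i) (g≗g′ (n ∸ i)))

⊛-congˡ : ∀ f {g g′} → g ≗ g′ → f ⊛ g ≗ f ⊛ g′
⊛-congˡ f = ⊛-cong {f} (λ _ → refl)

⊛-congʳ : ∀ g {f f′} → f ≗ f′ → f ⊛ g ≗ f′ ⊛ g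
⊛-congʳ g f≗f′ = ⊛-cong {g = g} f≗f′ (λ _ → refl)

⊛-comm : ∀ f g → f ⊛ g ≗ g ⊛ f
⊛-comm f g n = trans (sum<-reverse (suc n) (λ i → f i * g (n ∸ i)))
  (sum<-cong< (suc n) (λ i i<1+n → trans (cong (λ j → f (n ∸ i) * g j) (ℕₚ.m∸[m∸n]≡n (ℕₚ.≤-pred i<1+n)))
                                          (*-comm (f (n ∸ i)) (g i))))

⊛-assoc : ∀ f g h → (f ⊛ g) ⊛ h ≗ f ⊛ (g ⊛ h)
⊛-assoc f g h n = begin
    sum< (suc n) (λ l → sum< (suc l) (λ m → f m * g (l ∸ m)) * h (n ∸ l))
  ≡⟨ sum<-cong (suc n) (λ l → sym (sum<-*ʳ (suc l) (h (n ∸ l)) (λ m → f m * g (l ∸ m)))) ⟩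
    sum< (suc n) (λ l → sum< (suc l) (λ m → f m * g (l ∸ m) * h (n ∸ l)))
  ≡⟨ sum<-triangle n (λ m l → f m * g (l ∸ m) * h (n ∸ l)) ⟩
    sum< (suc n) (λ m → sum< (suc n ∸ m) (λ i → f m * g ((m +ℕ i) ∸ m) * h (n ∸ (m +ℕ i))))
  ≡⟨ sum<-cong< (suc n) (λ m m<1+n → row m (ℕₚ.≤-pred m<1+n)) ⟩
    sum< (suc n) (λ m → f m * (g ⊛ h) (n ∸ m))
  ∎
  where
  open ≡-Reasoning
  row : ∀ m → m ℕ.≤ n →
    sum< (suc n ∸ m) (λ i → f m * g ((m +ℕ i) ∸ m) * h (n ∸ (m +ℕ i))) ≡ f m * (g ⊛ h) (n ∸ m)
  row m m≤n rewrite ℕₚ.+-∸-assoc 1 m≤n = trans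
    (sum<-cong (suc (n ∸ m)) (λ i → trans
      (cong₂ (λ a b → f m * g a * h b) (ℕₚ.m+n∸m≡n m i) (sym (ℕₚ.∸-+-assoc n m i)))
      (*-assoc (f m) (g i) (h ((n ∸ m) ∸ i)))))
    (sum<-*ˡ (suc (n ∸ m)) (f m) (λ i → g i * h ((n ∸ m) ∸ i)))

⊛-distribˡ-⊕ : ∀ f g h → f ⊛ (g ⊕ h) ≗ (f ⊛ g) ⊕ (f ⊛ h)
⊛-distribˡ-⊕ f g h n = trans (sum<-cong (suc n) (λ i → *-distribˡ-+ (f i) (g (n ∸ i)) (h (n ∸ i))))
  (sum<-+ (suc n) (λ i → f i * g (n ∸ i)) (λ i → f i * h (n ∸ i)))

⊛-distribʳ-⊕ : ∀ f g h → (g ⊕ h) ⊛ f ≗ (g ⊛ f) ⊕ (h ⊛ f)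
⊛-distribʳ-⊕ f g h n = trans (⊛-comm (g ⊕ h) f n)
  (trans (⊛-distribˡ-⊕ f g h n) (cong₂ _+_ (⊛-comm f g n) (⊛-comm f h n)))

·-⊛ˡ : ∀ c f g → (c · f) ⊛ g ≗ c · (f ⊛ g)
·-⊛ˡ c f g n = trans (sum<-cong (suc n) (λ i → *-assoc c (f i) (g (n ∸ i))))
  (sum<-*ˡ (suc n) c (λ i → f i * g (n ∸ i)))

·-⊛ʳ : ∀ c f g → f ⊛ (c · g) ≗ c · (f ⊛ g)
·-⊛ʳ c f g n = trans (⊛-comm f (c · g) n) (trans (·-⊛ˡ c g f n) (cong (c *_) (⊛-comm g f n)))

const-⊛ : ∀ c f → const c ⊛ f ≗ c · f
const-⊛ c f n = trans (sum<-unconsˡ n (λ i → const c i * f (n ∸ i)))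
  (trans (cong (_+_ (c * f n)) (trans (sum<-cong n (λ i → *-zeroˡ (f (n ∸ suc i)))) (sum<-zero n)))
         (+-identityʳ (c * f n)))

⊛-const : ∀ c f → f ⊛ const c ≗ c · f
⊛-const c f n = trans (⊛-comm f (const c) n) (const-⊛ c f n)

⊛-identityˡ : ∀ f → const 1ℚ ⊛ f ≗ f
⊛-identityˡ f n = trans (const-⊛ 1ℚ f n) (*-identityˡ (f n))

⊛-identityʳ : ∀ f → f ⊛ const 1ℚ ≗ f
⊛-identityʳ f n = trans (⊛-comm f (const 1ℚ) n) (⊛-identityˡ f n)

scale-⊛ : ∀ c f g → scale c (f ⊛ g) ≗ scale c f ⊛ scale c g
scale-⊛ c f g n = trans (sym (sum<-*ˡ (suc n) (c ^ℚ n) (λ i → f i * g (n ∸ i))))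
  (sum<-cong< (suc n) (λ i i<1+n → begin
      c ^ℚ n * (f i * g (n ∸ i))
    ≡⟨ cong (λ e → c ^ℚ e * (f i * g (n ∸ i))) (sym (ℕₚ.m+[n∸m]≡n (ℕₚ.≤-pred i<1+n))) ⟩
      c ^ℚ (i +ℕ (n ∸ i)) * (f i * g (n ∸ i))
    ≡⟨ cong (_* (f i * g (n ∸ i))) (^ℚ-+ c i (n ∸ i)) ⟩
      c ^ℚ i * c ^ℚ (n ∸ i) * (f i * g (n ∸ i))
    ≡⟨ solve 4 (λ a b x y → (a :* b) :* (x :* y) := (a :* x) :* (b :* y)) refl
         (c ^ℚ i) (c ^ℚ (n ∸ i)) (f i) (g (n ∸ i)) ⟩
      c ^ℚ i * f i * (c ^ℚ (n ∸ i) * g (n ∸ i)) ∎))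
  where open ≡-Reasoning

scale-const : ∀ c d → scale c (const d) ≗ const d
scale-const c d zero    = *-identityˡ d
scale-const c d (suc n) = *-zeroʳ (c ^ℚ suc n)

divT-⊛ : ∀ f g → f 0 ≡ 0ℚ → divT f ⊛ g ≗ divT (f ⊛ g)
divT-⊛ f g f0≡0 n = sym (begin
    (f ⊛ g) (suc n)                  ≡⟨ sum<-unconsˡ (suc n) (λ i → f i * g (suc n ∸ i)) ⟩
    f 0 * g (suc n) + (divT f ⊛ g) n ≡⟨ cong (λ a → a * g (suc n) + (divT f ⊛ g) n) f0≡0 ⟩
    0ℚ * g (suc n) + (divT f ⊛ g) n  ≡⟨ cong (_+ (divT f ⊛ g) n) (*-zeroˡ (g (suc n))) ⟩
    0ℚ + (divT f ⊛ g) n              ≡⟨ +-identityˡ _ ⟩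
    (divT f ⊛ g) n                   ∎)
  where open ≡-Reasoning

invApprox-stable : ∀ f c N i → i ℕ.≤ N → invApprox f c N i ≡ invS f c i
invApprox-stable f c zero    .zero ℕ.z≤n = refl
invApprox-stable f c (suc N) i i≤1+N with ℕₚ.m≤n⇒m<n∨m≡n i≤1+N
... | inj₂ refl = refl
... | inj₁ i<1+N with i ≤ᵇ N in eq
...   | true  = invApprox-stable f c N i (ℕₚ.≤-pred i<1+N)
...   | false = ⊥-elim (subst T eq (ℕₚ.≤⇒≤ᵇ (ℕₚ.≤-pred i<1+N)))

invS-suc : ∀ f c N → invS f c (suc N) ≡ - (c * Σ[ 1 ⋯ suc N ] (λ j → f j * invApprox f c N (suc N ∸ j)))
invS-suc f c N with suc N ≤ᵇ N in eq
... | false = refl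
... | true  = ⊥-elim (ℕₚ.1+n≰n (ℕₚ.≤ᵇ⇒≤ (suc N) N (subst T (sym eq) _)))

⊛-invS : ∀ f c → c * f 0 ≡ 1ℚ → f ⊛ invS f c ≗ const 1ℚ
⊛-invS f c c*f0≡1 zero    = trans (+-identityˡ _) (trans (*-comm (f 0) c) c*f0≡1)
⊛-invS f c c*f0≡1 (suc N) = begin
    sum< (suc (suc N)) (λ i → f i * g (suc N ∸ i))
  ≡⟨ sum<-unconsˡ (suc N) (λ i → f i * g (suc N ∸ i)) ⟩
    f 0 * g (suc N) + S
  ≡⟨ cong (λ z → f 0 * z + S) (trans (invS-suc f c N) (cong (λ z → - (c * z)) (sym S≡))) ⟩
    f 0 * (- (c * S)) + S
  ≡⟨ solve 3 (λ a c s → a :* (:- (c :* s)) :+ s := (:- (c :* a) :+ con 1ℚ) :* s) refl (f 0) c S ⟩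
    (- (c * f 0) + 1ℚ) * S
  ≡⟨ cong (λ z → (- z + 1ℚ) * S) c*f0≡1 ⟩
    (- 1ℚ + 1ℚ) * S
  ≡⟨ *-zeroˡ S ⟩
    0ℚ
  ∎
  where
  open ≡-Reasoning
  g : FPS
  g = invS f c
  S : ℚ
  S = sum< (suc N) (λ i → f (suc i) * g (N ∸ i))
  S≡ : S ≡ Σ[ 1 ⋯ suc N ] (λ j → f j * invApprox f c N (suc N ∸ j))
  S≡ = sum<-cong (suc N) (λ i → cong (f (suc i) *_) (sym (invApprox-stable f c N (N ∸ i) (ℕₚ.m∸n≤m N i))))

invS-unique : ∀ f c g → c * f 0 ≡ 1ℚ → g ⊛ f ≗ const 1ℚ → g ≗ invS f c
invS-unique f c g c*f0≡1 g⊛f≗1 = begin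
    g                      ≈⟨ ⊛-identityʳ g ⟨
    g ⊛ const 1ℚ           ≈⟨ ⊛-congˡ g (⊛-invS f c c*f0≡1) ⟨
    g ⊛ (f ⊛ invS f c)     ≈⟨ ⊛-assoc g f (invS f c) ⟨
    (g ⊛ f) ⊛ invS f c     ≈⟨ ⊛-congʳ (invS f c) g⊛f≗1 ⟩
    const 1ℚ ⊛ invS f c    ≈⟨ ⊛-identityˡ (invS f c) ⟩
    invS f c               ∎
  where open ≗-Reasoning

deriv : FPS → FPS
deriv f n = ℕ→ℚ (suc n) * f (suc n)

deriv-⊛ : ∀ f g → deriv (f ⊛ g) ≗ (deriv f ⊛ g) ⊕ (f ⊛ deriv g)
deriv-⊛ f g n = begin
    ℕ→ℚ (suc n) * sum< (suc (suc n)) t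
  ≡⟨ sym (sum<-*ˡ (suc (suc n)) (ℕ→ℚ (suc n)) t) ⟩
    sum< (suc (suc n)) (λ i → ℕ→ℚ (suc n) * t i)
  ≡⟨ sum<-cong< (suc (suc n)) (λ i i<2+n → split i (ℕₚ.≤-pred i<2+n)) ⟩
    sum< (suc (suc n)) (λ i → ℕ→ℚ i * t i + ℕ→ℚ (suc n ∸ i) * t i)
  ≡⟨ sum<-+ (suc (suc n)) (λ i → ℕ→ℚ i * t i) (λ i → ℕ→ℚ (suc n ∸ i) * t i) ⟩
    sum< (suc (suc n)) (λ i → ℕ→ℚ i * t i) + sum< (suc (suc n)) (λ i → ℕ→ℚ (suc n ∸ i) * t i)
  ≡⟨ cong₂ _+_ differentiate-f differentiate-g ⟩
    (deriv f ⊛ g) n + (f ⊛ deriv g) n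
  ∎
  where
  open ≡-Reasoning
  t : ℕ → ℚ
  t i = f i * g (suc n ∸ i)
  split : ∀ i → i ℕ.≤ suc n → ℕ→ℚ (suc n) * t i ≡ ℕ→ℚ i * t i + ℕ→ℚ (suc n ∸ i) * t i
  split i i≤1+n = trans (cong (λ k → ℕ→ℚ k * t i) (sym (ℕₚ.m+[n∸m]≡n i≤1+n)))
    (trans (cong (_* t i) (ℕ→ℚ-homo-+ i (suc n ∸ i))) (*-distribʳ-+ (t i) (ℕ→ℚ i) (ℕ→ℚ (suc n ∸ i))))
  differentiate-f : sum< (suc (suc n)) (λ i → ℕ→ℚ i * t i) ≡ (deriv f ⊛ g) n
  differentiate-f = begin
      sum< (suc (suc n)) (λ i → ℕ→ℚ i * t i)
    ≡⟨ sum<-unconsˡ (suc n) (λ i → ℕ→ℚ i * t i) ⟩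
      0ℚ * t 0 + sum< (suc n) (λ i → ℕ→ℚ (suc i) * (f (suc i) * g (n ∸ i)))
    ≡⟨ cong₂ _+_ (*-zeroˡ (t 0))
         (sum<-cong (suc n) (λ i → sym (*-assoc (ℕ→ℚ (suc i)) (f (suc i)) (g (n ∸ i))))) ⟩
      0ℚ + (deriv f ⊛ g) n
    ≡⟨ +-identityˡ _ ⟩
      (deriv f ⊛ g) n ∎
  differentiate-g-at : ∀ i → i ℕ.≤ n → ℕ→ℚ (suc n ∸ i) * t i ≡ f i * deriv g (n ∸ i)
  differentiate-g-at i i≤n rewrite ℕₚ.+-∸-assoc 1 i≤n =
    solve 3 (λ s x y → s :* (x :* y) := x :* (s :* y)) refl (ℕ→ℚ (suc (n ∸ i))) (f i) (g (suc (n ∸ i)))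
  differentiate-g : sum< (suc (suc n)) (λ i → ℕ→ℚ (suc n ∸ i) * t i) ≡ (f ⊛ deriv g) n
  differentiate-g = begin
      sum< (suc n) (λ i → ℕ→ℚ (suc n ∸ i) * t i) + ℕ→ℚ (n ∸ n) * t (suc n)
    ≡⟨ cong₂ _+_ (sum<-cong< (suc n) (λ i i<1+n → differentiate-g-at i (ℕₚ.≤-pred i<1+n)))
                 (trans (cong (λ k → ℕ→ℚ k * t (suc n)) (ℕₚ.n∸n≡0 n)) (*-zeroˡ (t (suc n)))) ⟩
      (f ⊛ deriv g) n + 0ℚ
    ≡⟨ +-identityʳ _ ⟩
      (f ⊛ deriv g) n ∎

deriv-unique : ∀ c u v → u 0 ≡ v 0 → deriv u ≗ c · u → deriv v ≗ c · v → u ≗ v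
deriv-unique c u v u0≡v0 u′≗cu v′≗cv zero    = u0≡v0
deriv-unique c u v u0≡v0 u′≗cu v′≗cv (suc n) = suc-*-cancelˡ n
  (trans (u′≗cu n) (trans (cong (c *_) (deriv-unique c u v u0≡v0 u′≗cu v′≗cv n)) (sym (v′≗cv n))))

deriv-expS : ∀ a → deriv (expS a) ≗ a · expS a
deriv-expS a n = trans
  (solve 4 (λ s a p i → s :* ((a :* p) :* i) := a :* (p :* (s :* i))) refl (ℕ→ℚ (suc n)) a (a ^ℚ n) (inv! (suc n)))
  (cong (λ z → a * (a ^ℚ n * z)) (suc*inv!-suc n))

expS-+ : ∀ a b → expS a ⊛ expS b ≗ expS (a + b)
expS-+ a b = deriv-unique (a + b) (expS a ⊛ expS b) (expS (a + b)) refl deriv-product (deriv-expS (a + b))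
  where
  deriv-product : deriv (expS a ⊛ expS b) ≗ (a + b) · (expS a ⊛ expS b)
  deriv-product n = begin
      deriv (expS a ⊛ expS b) n
    ≡⟨ deriv-⊛ (expS a) (expS b) n ⟩
      (deriv (expS a) ⊛ expS b) n + (expS a ⊛ deriv (expS b)) n
    ≡⟨ cong₂ _+_ (⊛-congʳ (expS b) (deriv-expS a) n) (⊛-congˡ (expS a) (deriv-expS b) n) ⟩
      ((a · expS a) ⊛ expS b) n + (expS a ⊛ (b · expS b)) n
    ≡⟨ cong₂ _+_ (·-⊛ˡ a (expS a) (expS b) n) (·-⊛ʳ b (expS a) (expS b) n) ⟩
      a * (expS a ⊛ expS b) n + b * (expS a ⊛ expS b) n
    ≡⟨ sym (*-distribʳ-+ _ a b) ⟩
      (a + b) * (expS a ⊛ expS b) n ∎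
    where open ≡-Reasoning

scale-expS : ∀ c a → scale c (expS a) ≗ expS (c * a)
scale-expS c a n = trans (sym (*-assoc (c ^ℚ n) (a ^ℚ n) (inv! n))) (cong (_* inv! n) (sym (*-^ℚ c a n)))

powS-cong : ∀ {f g} → f ≗ g → ∀ m → powS f m ≗ powS g m
powS-cong f≗g zero    zero    = refl
powS-cong f≗g zero    (suc n) = refl
powS-cong f≗g (suc m)         = ⊛-cong f≗g (powS-cong f≗g m)

powS-scale : ∀ c f m → powS (scale c f) m ≗ scale c (powS f m)
powS-scale c f zero    zero    = refl
powS-scale c f zero    (suc n) = sym (*-zeroʳ (c ^ℚ suc n))
powS-scale c f (suc m)         =
  ≗-trans (⊛-congˡ (scale c f) (powS-scale c f m)) (≗-sym (scale-⊛ c f (powS f m)))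

powS-· : ∀ c f m → powS (c · f) m ≗ (c ^ℚ m) · powS f m
powS-· c f zero    zero    = sym (*-identityˡ 1ℚ)
powS-· c f zero    (suc n) = sym (*-zeroʳ 1ℚ)
powS-· c f (suc m) n = begin
    ((c · f) ⊛ powS (c · f) m) n
  ≡⟨ ⊛-congˡ (c · f) (powS-· c f m) n ⟩
    ((c · f) ⊛ (c ^ℚ m · powS f m)) n
  ≡⟨ ·-⊛ʳ (c ^ℚ m) (c · f) (powS f m) n ⟩
    c ^ℚ m * ((c · f) ⊛ powS f m) n
  ≡⟨ cong (c ^ℚ m *_) (·-⊛ˡ c f (powS f m) n) ⟩
    c ^ℚ m * (c * (f ⊛ powS f m) n)
  ≡⟨ solve 3 (λ p c y → p :* (c :* y) := (c :* p) :* y) refl (c ^ℚ m) c ((f ⊛ powS f m) n) ⟩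
    c ^ℚ suc m * (f ⊛ powS f m) n ∎
  where open ≡-Reasoning

two : ℚ
two = ℕ→ℚ 2

expMinusOne/t : FPS
expMinusOne/t = divT expMinusOne

t/expMinusOne : FPS
t/expMinusOne = invS expMinusOne/t 1ℚ

expMinusOne⊛expPlusOne : expMinusOne ⊛ expPlusOne ≗ scale two expMinusOne
expMinusOne⊛expPlusOne n = begin
    (expMinusOne ⊛ expPlusOne) n
  ≡⟨ ⊛-distribʳ-⊕ expPlusOne e (const (- 1ℚ)) n ⟩
    (e ⊛ expPlusOne) n + (const (- 1ℚ) ⊛ expPlusOne) n
  ≡⟨ cong₂ _+_ (⊛-distribˡ-⊕ e e (const 1ℚ) n) (const-⊛ (- 1ℚ) expPlusOne n) ⟩
    ((e ⊛ e) n + (e ⊛ const 1ℚ) n) + (- 1ℚ) * (e n + const 1ℚ n)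
  ≡⟨ cong₂ (λ a b → (a + b) + (- 1ℚ) * (e n + const 1ℚ n)) (expS-+ 1ℚ 1ℚ n) (⊛-const 1ℚ e n) ⟩
    (expS two n + 1ℚ * e n) + (- 1ℚ) * (e n + const 1ℚ n)
  ≡⟨ solve 3 (λ x y d → (x :+ con 1ℚ :* y) :+ con (- 1ℚ) :* (y :+ d) := x :+ con (- 1ℚ) :* d) refl
       (expS two n) (e n) (const 1ℚ n) ⟩
    expS two n + (- 1ℚ) * const 1ℚ n
  ≡⟨ cong₂ _+_ (sym (scale-expS two 1ℚ n)) (trans (-1*const1 n) (sym (scale-const two (- 1ℚ) n))) ⟩
    two ^ℚ n * e n + two ^ℚ n * const (- 1ℚ) n
  ≡⟨ sym (*-distribˡ-+ (two ^ℚ n) (e n) (const (- 1ℚ) n)) ⟩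
    scale two expMinusOne n ∎
  where
  open ≡-Reasoning
  e : FPS
  e = expS 1ℚ
  -1*const1 : ∀ n → (- 1ℚ) * const 1ℚ n ≡ const (- 1ℚ) n
  -1*const1 zero    = refl
  -1*const1 (suc n) = *-zeroʳ (- 1ℚ)

expMinusOne/t⊛expPlusOne : expMinusOne/t ⊛ expPlusOne ≗ two · scale two expMinusOne/t
expMinusOne/t⊛expPlusOne n = trans (divT-⊛ expMinusOne expPlusOne refl n)
  (trans (expMinusOne⊛expPlusOne (suc n)) (*-assoc two (two ^ℚ n) (expMinusOne (suc n))))

invS-expPlusOne : invS expPlusOne ½ ≗ ½ · (expMinusOne/t ⊛ scale two t/expMinusOne)
invS-expPlusOne = ≗-sym (invS-unique expPlusOne ½ (½ · (Q ⊛ J)) refl (begin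
    (½ · (Q ⊛ J)) ⊛ expPlusOne        ≈⟨ ·-⊛ˡ ½ (Q ⊛ J) expPlusOne ⟩
    ½ · ((Q ⊛ J) ⊛ expPlusOne)        ≈⟨ ·-cong ½ (⊛-congʳ expPlusOne (⊛-comm Q J)) ⟩
    ½ · ((J ⊛ Q) ⊛ expPlusOne)        ≈⟨ ·-cong ½ (⊛-assoc J Q expPlusOne) ⟩
    ½ · (J ⊛ (Q ⊛ expPlusOne))        ≈⟨ ·-cong ½ (⊛-congˡ J expMinusOne/t⊛expPlusOne) ⟩
    ½ · (J ⊛ (two · scale two Q))     ≈⟨ ·-cong ½ (·-⊛ʳ two J (scale two Q)) ⟩
    ½ · (two · (J ⊛ scale two Q))     ≈⟨ ·-cong ½ (·-cong two J⊛scaleQ≗1) ⟩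
    ½ · (two · const 1ℚ)              ≈⟨ (λ n → solve 1 (λ y → con ½ :* (con two :* y) := y) refl (const 1ℚ n)) ⟩
    const 1ℚ                          ∎))
  where
  open ≗-Reasoning
  Q J : FPS
  Q = expMinusOne/t
  J = scale two t/expMinusOne
  J⊛scaleQ≗1 : J ⊛ scale two Q ≗ const 1ℚ
  J⊛scaleQ≗1 = begin
    scale two t/expMinusOne ⊛ scale two Q  ≈⟨ scale-⊛ two t/expMinusOne Q ⟨
    scale two (t/expMinusOne ⊛ Q)          ≈⟨ scale-cong two (⊛-comm t/expMinusOne Q) ⟩
    scale two (Q ⊛ t/expMinusOne)          ≈⟨ scale-cong two (⊛-invS Q 1ℚ refl) ⟩
    scale two (const 1ℚ)                   ≈⟨ scale-const two 1ℚ ⟩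
    const 1ℚ                               ∎

polyEuler-gf : ∀ P x →
  (P ⊛ invS expPlusOne ½) ⊛ expS x ≗ ½ · ((P ⊛ expMinusOne/t) ⊛ scale two (t/expMinusOne ⊛ expS (x * ½)))
polyEuler-gf P x = begin
    (P ⊛ invS expPlusOne ½) ⊛ expS x      ≈⟨ ⊛-congʳ (expS x) (⊛-congˡ P invS-expPlusOne) ⟩
    (P ⊛ (½ · (Q ⊛ J))) ⊛ expS x          ≈⟨ ⊛-congʳ (expS x) (·-⊛ʳ ½ P (Q ⊛ J)) ⟩
    (½ · (P ⊛ (Q ⊛ J))) ⊛ expS x          ≈⟨ ·-⊛ˡ ½ (P ⊛ (Q ⊛ J)) (expS x) ⟩
    ½ · ((P ⊛ (Q ⊛ J)) ⊛ expS x)          ≈⟨ ·-cong ½ (⊛-congʳ (expS x) (⊛-assoc P Q J)) ⟨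
    ½ · (((P ⊛ Q) ⊛ J) ⊛ expS x)          ≈⟨ ·-cong ½ (⊛-assoc (P ⊛ Q) J (expS x)) ⟩
    ½ · ((P ⊛ Q) ⊛ (J ⊛ expS x))          ≈⟨ ·-cong ½ (⊛-congˡ (P ⊛ Q) (⊛-congˡ J expS-x≗)) ⟩
    ½ · ((P ⊛ Q) ⊛ (J ⊛ scale two X))     ≈⟨ ·-cong ½ (⊛-congˡ (P ⊛ Q) (scale-⊛ two t/expMinusOne X)) ⟨
    ½ · ((P ⊛ Q) ⊛ scale two (t/expMinusOne ⊛ X)) ∎
  where
  open ≗-Reasoning
  Q J X : FPS
  Q = expMinusOne/t
  J = scale two t/expMinusOne
  X = expS (x * ½)
  expS-x≗ : expS x ≗ scale two X
  expS-x≗ n = sym (trans (scale-expS two (x * ½) n)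
    (cong (λ y → expS y n) (solve 1 (λ y → con two :* (y :* con ½) := y) refl x)))

expMinusOne/t-coeff : ∀ i → expMinusOne/t i ≡ inv! i * (+ 1 / suc i)
expMinusOne/t-coeff i = trans (+-identityʳ _)
  (trans (cong (_* inv! (suc i)) (1^ℚ (suc i))) (trans (*-identityˡ _) (inv!-suc i)))

powS-expMinusOne : ∀ j N → powS expMinusOne j N ≡ ℕ→ℚ (j !) * inv! N * stirling2 N j
powS-expMinusOne j N = sym (begin
    ℕ→ℚ (j !) * inv! N * (ℕ→ℚ (N !) * inv! j * p)
  ≡⟨ solve 5 (λ J iN N iJ p → J :* iN :* (N :* iJ :* p) := (iJ :* J) :* (iN :* N) :* p) refl
       (ℕ→ℚ (j !)) (inv! N) (ℕ→ℚ (N !)) (inv! j) p ⟩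
    (inv! j * ℕ→ℚ (j !)) * (inv! N * ℕ→ℚ (N !)) * p
  ≡⟨ cong₂ (λ a b → a * b * p) (inv!-inverseˡ j) (inv!-inverseˡ N) ⟩
    1ℚ * 1ℚ * p
  ≡⟨ *-identityˡ p ⟩
    p ∎)
  where
  open ≡-Reasoning
  p : ℚ
  p = powS expMinusOne j N

oneMinusExpNeg2≗ : oneMinusExpNeg2 ≗ scale (- 1ℚ * two) ((- 1ℚ) · expMinusOne)
oneMinusExpNeg2≗ zero    = refl
oneMinusExpNeg2≗ (suc n) = trans
  (solve 2 (λ p i → con 0ℚ :+ :- (p :* i) := p :* (con (- 1ℚ) :* (con 1ℚ :* i :+ con 0ℚ))) refl
     ((- 1ℚ * two) ^ℚ suc n) (inv! (suc n)))
  (cong (λ z → (- 1ℚ * two) ^ℚ suc n * ((- 1ℚ) * (z * inv! (suc n) + 0ℚ))) (sym (1^ℚ (suc n))))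

powS-oneMinusExpNeg2 : ∀ j m →
  powS oneMinusExpNeg2 j (suc m) ≡ two ^ℚ suc m * sgn (suc m +ℕ j) * powS expMinusOne j (suc m)
powS-oneMinusExpNeg2 j m = begin
    powS oneMinusExpNeg2 j (suc m)
  ≡⟨ powS-cong oneMinusExpNeg2≗ j (suc m) ⟩
    powS (scale (- 1ℚ * two) ((- 1ℚ) · expMinusOne)) j (suc m)
  ≡⟨ powS-scale (- 1ℚ * two) ((- 1ℚ) · expMinusOne) j (suc m) ⟩
    (- 1ℚ * two) ^ℚ suc m * powS ((- 1ℚ) · expMinusOne) j (suc m)
  ≡⟨ cong₂ _*_ (*-^ℚ (- 1ℚ) two (suc m)) (powS-· (- 1ℚ) expMinusOne j (suc m)) ⟩
    (sgn (suc m) * two ^ℚ suc m) * (sgn j * p)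
  ≡⟨ solve 4 (λ s t s′ p → (s :* t) :* (s′ :* p) := t :* (s :* s′) :* p) refl (sgn (suc m)) (two ^ℚ suc m) (sgn j) p ⟩
    two ^ℚ suc m * (sgn (suc m) * sgn j) * p
  ≡⟨ cong (λ s → two ^ℚ suc m * s * p) (sym (^ℚ-+ (- 1ℚ) (suc m) j)) ⟩
    two ^ℚ suc m * sgn (suc m +ℕ j) * p ∎
  where
  open ≡-Reasoning
  p : ℚ
  p = powS expMinusOne j (suc m)

bernoulliPoly-coeff : ∀ n y → (t/expMinusOne ⊛ expS y) n ≡ inv! n * bernoulliPoly n y
bernoulliPoly-coeff n y = sym (trans (sym (*-assoc (inv! n) (ℕ→ℚ (n !)) _))
  (trans (cong (_* (t/expMinusOne ⊛ expS y) n) (inv!-inverseˡ n)) (*-identityˡ _)))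

⊛-⊛-coeff : ∀ c f g h n → c * ((f ⊛ g) ⊛ h) n ≡
  Σ[ 0 ⋯ n ] (λ l → Σ[ 0 ⋯ l ] (λ m → c * (f m * g (l ∸ m) * h (n ∸ l))))
⊛-⊛-coeff c f g h n = trans (sym (sum<-*ˡ (suc n) c (λ l → (f ⊛ g) l * h (n ∸ l))))
  (sum<-cong (suc n) (λ l → sum<-distrib (suc l) c (h (n ∸ l)) (λ m → f m * g (l ∸ m))))

summand : ℕ → ℤ → ℚ → ℕ → ℕ → ℕ → ℚ
summand n k x l m j =
  ℕ→ℚ (n C l) * ℕ→ℚ (l C m)
  * (ℕ→ℚ 2 ^ℚ (m +ℕ (n ∸ l)) * sgn (suc m +ℕ j) * ℕ→ℚ (j !)
     * (+ 1 / suc (l ∸ m)) * inv-pow (j ∸ 1) k * (+ 1 / suc m))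
  * stirling2 (suc m) j * bernoulliPoly (n ∸ l) (x * ½)

summand-eq : ∀ n k x l m i → l ℕ.≤ n → m ℕ.≤ l →
  ℕ→ℚ (n !) * ½ * (inv-pow i k * powS oneMinusExpNeg2 (suc i) (suc m) * expMinusOne/t (l ∸ m)
                   * scale two (t/expMinusOne ⊛ expS (x * ½)) (n ∸ l))
  ≡ summand n k x l m (suc i)
summand-eq n k x l m i l≤n m≤l = begin
    shape (powS oneMinusExpNeg2 j (suc m)) (expMinusOne/t (l ∸ m)) R
  ≡⟨ cong₂ (λ o r → shape o (expMinusOne/t (l ∸ m)) r)
       (trans (powS-oneMinusExpNeg2 j m) (cong (two ^ℚ suc m * sg *_) (powS-expMinusOne j (suc m))))
       (bernoulliPoly-coeff (n ∸ l) (x * ½)) ⟩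
    shape (two ^ℚ suc m * sg * (jf * inv! (suc m) * S)) (expMinusOne/t (l ∸ m)) (inv! (n ∸ l) * B)
  ≡⟨ cong₂ (λ a q → shape (two ^ℚ suc m * sg * (jf * a * S)) q (inv! (n ∸ l) * B))
       (inv!-suc m) (expMinusOne/t-coeff (l ∸ m)) ⟩
    shape (two * two ^ℚ m * sg * (jf * (inv! m * r₂) * S)) (inv! (l ∸ m) * r₁) (inv! (n ∸ l) * B)
  ≡⟨ solve 13 (λ N IP p sg jf a r₂ S b r₁ q c B →
        N :* con ½ :* (IP :* (con two :* p :* sg :* (jf :* (a :* r₂) :* S)) :* (b :* r₁) :* (q :* (c :* B)))
        := N :* (a :* b :* c) :* (p :* q :* sg :* jf :* r₁ :* IP :* r₂) :* S :* B)
       refl N IP (two ^ℚ m) sg jf (inv! m) r₂ S (inv! (l ∸ m)) r₁ (two ^ℚ (n ∸ l)) (inv! (n ∸ l)) B ⟩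
    N * (inv! m * inv! (l ∸ m) * inv! (n ∸ l)) * (two ^ℚ m * two ^ℚ (n ∸ l) * sg * jf * r₁ * IP * r₂) * S * B
  ≡⟨ cong₂ (λ c p → c * (p * sg * jf * r₁ * IP * r₂) * S * B)
       (multinomial n l m l≤n m≤l) (sym (^ℚ-+ two m (n ∸ l))) ⟩
    summand n k x l m j ∎
  where
  open ≡-Reasoning
  j : ℕ
  j = suc i
  N IP sg jf S R B r₁ r₂ : ℚ
  N  = ℕ→ℚ (n !)
  IP = inv-pow i k
  sg = sgn (suc m +ℕ j)
  jf = ℕ→ℚ (j !)
  S  = stirling2 (suc m) j
  R  = (t/expMinusOne ⊛ expS (x * ½)) (n ∸ l)
  B  = bernoulliPoly (n ∸ l) (x * ½)
  r₁ = + 1 / suc (l ∸ m)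
  r₂ = + 1 / suc m
  shape : ℚ → ℚ → ℚ → ℚ
  shape o q r = N * ½ * (IP * o * q * (two ^ℚ (n ∸ l) * r))

mainTheorem2 : (n : ℕ) (k : ℤ) (x : ℚ) →
    polyEuler n k x ≡
      Σ[ 0 ⋯ n ] (λ l → Σ[ 0 ⋯ l ] (λ m → Σ[ 1 ⋯ suc m ] (λ j →
        ℕ→ℚ (n C l) * ℕ→ℚ (l C m)
        * (ℕ→ℚ 2 ^ℚ (m +ℕ (n ∸ l)) * sgn (suc m +ℕ j) * ℕ→ℚ (j !)
           * (+ 1 / suc (l ∸ m)) * inv-pow (j ∸ 1) k * (+ 1 / suc m))
        * stirling2 (suc m) j * bernoulliPoly (n ∸ l) (x * ½))))
mainTheorem2 n k x = begin
    ℕ→ℚ (n !) * ((P ⊛ invS expPlusOne ½) ⊛ expS x) n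
  ≡⟨ cong (ℕ→ℚ (n !) *_) (polyEuler-gf P x n) ⟩
    ℕ→ℚ (n !) * (½ * ((P ⊛ expMinusOne/t) ⊛ R) n)
  ≡⟨ sym (*-assoc (ℕ→ℚ (n !)) ½ _) ⟩
    ℕ→ℚ (n !) * ½ * ((P ⊛ expMinusOne/t) ⊛ R) n
  ≡⟨ ⊛-⊛-coeff (ℕ→ℚ (n !) * ½) P expMinusOne/t R n ⟩
    Σ[ 0 ⋯ n ] (λ l → Σ[ 0 ⋯ l ] (λ m → ℕ→ℚ (n !) * ½ * (P m * expMinusOne/t (l ∸ m) * R (n ∸ l))))
  ≡⟨ sum<-cong< (suc n) (λ l l<1+n → sum<-cong< (suc l) (λ m m<1+l →
       trans (expand-Li (suc m) (ℕ→ℚ (n !) * ½) (expMinusOne/t (l ∸ m)) (R (n ∸ l)) _)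
             (sum<-cong (suc m) (λ i → summand-eq n k x l m i (ℕₚ.≤-pred l<1+n) (ℕₚ.≤-pred m<1+l))))) ⟩
    Σ[ 0 ⋯ n ] (λ l → Σ[ 0 ⋯ l ] (λ m → Σ[ 1 ⋯ suc m ] (summand n k x l m)))
  ∎
  where
  open ≡-Reasoning
  P R : FPS
  P = divT (LiS k oneMinusExpNeg2)
  R = scale two (t/expMinusOne ⊛ expS (x * ½))
  expand-Li : ∀ len c q r (f : ℕ → ℚ) → c * (sum< len f * q * r) ≡ sum< len (λ i → c * (f i * q * r))
  expand-Li len c q r f = trans (cong (λ z → c * (z * r)) (sym (sum<-*ʳ len q f))) (sum<-distrib len c r (λ i → f i * q))
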